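{- Let $k\geq 1$, let $G=(V,E)$ be a $k$-connected graph with nonnegative node weight function $c$, let $T\subseteq V$, and let $w(uv)=(c(u)+c(v))/2$ for each edge $uv\in E$. Let $F$ be the output of Algorithm 1 on this input (with any subroutine $\mathcal A$ for S$k$CS). Then $c(V(F))\leq \frac{2}{k}\,w(E(F))$, where $c(V(F))=\sum_{v\in V(F)}c(v)$ and $w(E(F))=\sum_{e\in E(F)}w(e)$.
   Context: Subset $k$-connected subgraph problem (S$k$CS): given a graph $G$ with edge weights $w$ and a terminal set $T\subseteq V(G)$, find a subgraph $F$ of $G$ such that every pair $u,v\in T$ is joined by at least $k$ internally disjoint paths in $F$, minimizing $\sum_{e\in E(F)}w(e)$. A $k$-block of a graph is a $k$-connected subgraph that has no $k$-separator (i.e. it is either a complete graph on $k+1$ nodes or $(k+1)$-connected), arising in the decomposition of a $k$-connected graph along $k$-separators; any feasible S$k$CS solution contains a $k$-connected such block containing all of $T$. Algorithm 1 (input: a $k$-connected graph $G$ with node weights $c$, terminal set $T$, and an algorithm $\mathcal A$ for S$k$CS): (1) define edge weights $w(uv)=(c(u)+c(v))/2$; (2) run $\mathcal A$ on $(G,T,w)$ to get a subset $k$-connected subgraph $F_0$; (3) let $F$ be a $k$-block of $F_0$ containing $T$; (4) output $F$. In particular the output $F$ is $k$-connected.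
   Formalization: The node weight function c takes nonnegative rational values instead of real ones, so the edge weights w and the sums $c(V(F))$ and $w(E(F))$ are rational as well. -}

module Defs where

open import Data.Nat as ℕ using (ℕ; zero; suc; _<ᵇ_)
open import Data.Bool using (Bool; true; false; if_then_else_; _∧_)
open import Data.Fin using (Fin; toℕ; zero; suc)
open import Data.Fin.Subset using (Subset; _∈_; _∉_; _⊆_; ∣_∣)
open import Data.Vec using (lookup)
open import Data.List using (List; []; _∷_)
open import Data.List.Membership.Propositional using () renaming (_∈_ to _∈ₗ_)
open import Data.List.Relation.Unary.Unique.Propositional using (Unique)
open import Data.Rational using (ℚ; 0ℚ; _+_; _*_; ½)
open import Data.Product using (Σ; _×_)
open import Relation.Nullary using (¬_)
open import Relation.Binary.PropositionalEquality using (_≡_; _≢_)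

record Graph (n : ℕ) : Set where
  field
    V     : Subset n
    E     : Fin n → Fin n → Bool
    E-sym : ∀ u v → E u v ≡ E v u
    E-irr : ∀ v → E v v ≡ false
    E-end : ∀ u v → E u v ≡ true → u ∈ V
open Graph public

Subgraph : ∀ {n} → Graph n → Graph n → Set
Subgraph H G = (V H ⊆ V G) × (∀ u v → E H u v ≡ true → E G u v ≡ true)

data Walk {n} (H : Graph n) (S : Subset n) : Fin n → Fin n → Set where
  nil  : ∀ {u} → u ∈ V H → u ∉ S → Walk H S u u
  cons : ∀ {u w v} → E H u w ≡ true → u ∉ S → Walk H S w v → Walk H S u v

ConnectedMinus : ∀ {n} → Graph n → Subset n → Set
ConnectedMinus H S = ∀ u v → u ∈ V H → u ∉ S → v ∈ V H → v ∉ S → Walk H S u v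

KConnected : ∀ {n} → ℕ → Graph n → Set
KConnected k H = (suc k ℕ.≤ ∣ V H ∣) ×
  (∀ S → S ⊆ V H → ∣ S ∣ ℕ.< k → ConnectedMinus H S)

KSeparator : ∀ {n} → ℕ → Graph n → Subset n → Set
KSeparator k H S = (S ⊆ V H) × (∣ S ∣ ≡ k) × ¬ ConnectedMinus H S

KBlock : ∀ {n} → ℕ → Graph n → Graph n → Set
KBlock k F0 F = Subgraph F F0 × KConnected k F × (∀ S → ¬ KSeparator k F S)

-- Walk in H written as u followed by the list xs of remaining vertices, ending at v
IsWalkL : ∀ {n} → Graph n → Fin n → List (Fin n) → Fin n → Set
IsWalkL H u []       v = (u ≡ v) × (u ∈ V H)
IsWalkL H u (x ∷ xs) v = (E H u x ≡ true) × IsWalkL H x xs v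

IsPath : ∀ {n} → Graph n → Fin n → List (Fin n) → Fin n → Set
IsPath H u xs v = IsWalkL H u xs v × Unique (u ∷ xs)

-- interior vertices of the path u ∷ xs (drop the final vertex of xs)
interior : ∀ {n} → List (Fin n) → List (Fin n)
interior []           = []
interior (x ∷ [])     = []
interior (x ∷ y ∷ ys) = x ∷ interior (y ∷ ys)

SubsetKConnected : ∀ {n} → ℕ → Graph n → Subset n → Set
SubsetKConnected {n} k H T = ∀ u v → u ∈ T → v ∈ T → u ≢ v →
  Σ (Fin k → List (Fin n)) λ P →
    (∀ i → IsPath H u (P i) v) ×
    (∀ i j → i ≢ j → (P i ≢ P j) ×
       (∀ x → x ∈ₗ interior (P i) → ¬ (x ∈ₗ interior (P j))))

sumFin : ∀ n → (Fin n → ℚ) → ℚ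
sumFin zero    f = 0ℚ
sumFin (suc n) f = f zero + sumFin n (λ i → f (suc i))

cV : ∀ {n} → (Fin n → ℚ) → Graph n → ℚ
cV {n} c F = sumFin n (λ v → if lookup (V F) v then c v else 0ℚ)

wt : ∀ {n} → (Fin n → ℚ) → Fin n → Fin n → ℚ
wt c u v = (c u + c v) * ½

-- w(E(F)): each edge {u,v} counted once, via u < v
wE : ∀ {n} → (Fin n → ℚ) → Graph n → ℚ
wE {n} c F = sumFin n (λ u → sumFin n (λ v →
  if E F u v ∧ (toℕ u <ᵇ toℕ v) then wt c u v else 0ℚ))

-- Only the k-connectivity of the block F matters. Every vertex of a k-connected
-- graph has at least k neighbours, since otherwise its neighbourhood would be a
-- separator of size < k isolating it. Summing w(uv) = (c(u) + c(v))/2 over the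
-- edges counts c(v) once for each half of an edge at v, so
-- 2 w(E(F)) = Σ_v deg(v) c(v) ≥ k c(V(F)).

module Submission where

open import Algebra.Bundles using (CommutativeRing)
open import Data.Bool using (Bool; true; false; if_then_else_; _∧_; T)
open import Data.Empty using (⊥; ⊥-elim)
open import Data.Fin using (Fin; zero; suc; toℕ)
open import Data.Fin.Properties using (toℕ-injective)
open import Data.Fin.Subset using (Subset; _∈_; _∉_; _⊆_; ∣_∣; _∪_; ⁅_⁆; inside; outside)
open import Data.Fin.Subset.Properties using (x∈p∪q⁺; x∈⁅x⁆; ∣⁅x⁆∣≡1)
open import Data.Integer as ℤ using (+_)
import Data.Integer.Properties as ℤ
open import Data.Nat as ℕ using (ℕ; zero; suc; z≤n; s≤s; NonZero; _<ᵇ_)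
import Data.Nat.Properties as ℕ
open import Data.Product using (∃; _×_; _,_)
open import Data.Rational using (ℚ; 0ℚ; 1ℚ; _+_; _*_; _/_; _≤_; ½; toℚᵘ; NonNegative)
open import Data.Rational.Properties
import Data.Rational.Unnormalised as ℚᵘ
import Data.Rational.Unnormalised.Properties as ℚᵘ
open import Data.Sum using (inj₁; inj₂)
open import Data.Vec using (tabulate; lookup; _∷_; []; here; there)
open import Data.Vec.Properties using ([]=⇒lookup; lookup⇒[]=; lookup∘tabulate)
open import Defs
open import Relation.Binary.PropositionalEquality

open CommutativeRing +-*-commutativeRing using (semiring)
open import Algebra.Properties.Semiring.Sum semiring
  using (sum; sum-syntax; ∑-comm; ∑-distrib-+; sum-cong-≗; *-distribˡ-sum)
import Algebra.Properties.Semiring.Mult semiring as Mult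

∣p∪q∣≤∣p∣+∣q∣ : ∀ {n} (p q : Subset n) → ∣ p ∪ q ∣ ℕ.≤ ∣ p ∣ ℕ.+ ∣ q ∣
∣p∪q∣≤∣p∣+∣q∣ []            []            = z≤n
∣p∪q∣≤∣p∣+∣q∣ (inside  ∷ p) (inside  ∷ q) =
  s≤s (ℕ.≤-trans (∣p∪q∣≤∣p∣+∣q∣ p q) (ℕ.+-monoʳ-≤ ∣ p ∣ (ℕ.n≤1+n ∣ q ∣)))
∣p∪q∣≤∣p∣+∣q∣ (inside  ∷ p) (outside ∷ q) = s≤s (∣p∪q∣≤∣p∣+∣q∣ p q)
∣p∪q∣≤∣p∣+∣q∣ (outside ∷ p) (inside  ∷ q) =
  ℕ.≤-trans (s≤s (∣p∪q∣≤∣p∣+∣q∣ p q)) (ℕ.≤-reflexive (sym (ℕ.+-suc ∣ p ∣ ∣ q ∣)))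
∣p∪q∣≤∣p∣+∣q∣ (outside ∷ p) (outside ∷ q) = ∣p∪q∣≤∣p∣+∣q∣ p q

∣p∪⁅x⁆∣≤1+∣p∣ : ∀ {n} (p : Subset n) (x : Fin n) → ∣ p ∪ ⁅ x ⁆ ∣ ℕ.≤ suc ∣ p ∣
∣p∪⁅x⁆∣≤1+∣p∣ p x = ℕ.≤-trans (∣p∪q∣≤∣p∣+∣q∣ p ⁅ x ⁆)
  (ℕ.≤-reflexive (trans (cong (∣ p ∣ ℕ.+_) (∣⁅x⁆∣≡1 x)) (ℕ.+-comm ∣ p ∣ 1)))

∃-∈-∉ : ∀ {n} (p q : Subset n) → ∣ p ∣ ℕ.< ∣ q ∣ → ∃ λ x → x ∈ q × x ∉ p
∃-∈-∉ (outside ∷ p) (inside  ∷ q) _ = zero , here , λ ()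
∃-∈-∉ (inside  ∷ p) (inside  ∷ q) (s≤s lt) with ∃-∈-∉ p q lt
... | x , x∈q , x∉p = suc x , there x∈q , λ { (there x∈p) → x∉p x∈p }
∃-∈-∉ (outside ∷ p) (outside ∷ q) lt with ∃-∈-∉ p q lt
... | x , x∈q , x∉p = suc x , there x∈q , λ { (there x∈p) → x∉p x∈p }
∃-∈-∉ (inside  ∷ p) (outside ∷ q) lt with ∃-∈-∉ p q (ℕ.<-trans (ℕ.n<1+n _) lt)
... | x , x∈q , x∉p = suc x , there x∈q , λ { (there x∈p) → x∉p x∈p }

∃-∈-∉-≢ : ∀ {n} (p q : Subset n) (y : Fin n) → suc ∣ p ∣ ℕ.< ∣ q ∣ →
  ∃ λ x → x ∈ q × x ∉ p × x ≢ y
∃-∈-∉-≢ p q y lt with ∃-∈-∉ (p ∪ ⁅ y ⁆) q (ℕ.≤-<-trans (∣p∪⁅x⁆∣≤1+∣p∣ p y) lt)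
... | x , x∈q , x∉p∪y =
  x , x∈q , (λ x∈p → x∉p∪y (x∈p∪q⁺ (inj₁ x∈p))) , λ { refl → x∉p∪y (x∈p∪q⁺ (inj₂ (x∈⁅x⁆ y))) }

module _ {n} (F : Graph n) where

  adjacent⇒≢ : ∀ {u v} → E F u v ≡ true → u ≢ v
  adjacent⇒≢ {u} uv refl with trans (sym uv) (E-irr F u)
  ... | ()

  neighbours : Fin n → Subset n
  neighbours v = tabulate (E F v)

  degree : Fin n → ℕ
  degree v = ∣ neighbours v ∣

  ∈-neighbours⁻ : ∀ {v u} → u ∈ neighbours v → E F v u ≡ true
  ∈-neighbours⁻ {v} {u} u∈N = trans (sym (lookup∘tabulate (E F v) u)) ([]=⇒lookup u∈N)

  ∈-neighbours⁺ : ∀ {v u} → E F v u ≡ true → u ∈ neighbours v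
  ∈-neighbours⁺ {v} {u} vu = lookup⇒[]= u (neighbours v) (trans (lookup∘tabulate (E F v) u) vu)

  neighbours⊆V : ∀ v → neighbours v ⊆ V F
  neighbours⊆V v {u} u∈N = E-end F u v (trans (E-sym F u v) (∈-neighbours⁻ u∈N))

  v∉neighbours[v] : ∀ v → v ∉ neighbours v
  v∉neighbours[v] v v∈N = adjacent⇒≢ (∈-neighbours⁻ v∈N) refl

  walk-avoiding-neighbours-is-trivial : ∀ {v u} → Walk F (neighbours v) v u → u ≡ v
  walk-avoiding-neighbours-is-trivial (nil _ _)                 = refl
  walk-avoiding-neighbours-is-trivial (cons vw _ (nil _ w∉N))    = ⊥-elim (w∉N (∈-neighbours⁺ vw))
  walk-avoiding-neighbours-is-trivial (cons vw _ (cons _ w∉N _)) = ⊥-elim (w∉N (∈-neighbours⁺ vw))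

  KConnected⇒k≤degree : ∀ {k} → KConnected k F → ∀ {v} → v ∈ V F → k ℕ.≤ degree v
  KConnected⇒k≤degree {k} (k<∣V∣ , connected) {v} v∈V = ℕ.≮⇒≥ degree≮k
    where
    degree≮k : degree v ℕ.< k → ⊥
    degree≮k d<k with ∃-∈-∉-≢ (neighbours v) (V F) v (ℕ.<-≤-trans (s≤s d<k) k<∣V∣)
    ... | u , u∈V , u∉N , u≢v = u≢v (walk-avoiding-neighbours-is-trivial
            (connected (neighbours v) (neighbours⊆V v) d<k v u v∈V (v∉neighbours[v] v) u∈V u∉N))

sumFin≡sum : ∀ n (f : Fin n → ℚ) → sumFin n f ≡ sum f
sumFin≡sum zero    f = refl
sumFin≡sum (suc n) f = cong (λ s → f zero + s) (sumFin≡sum n (λ i → f (suc i)))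

∑-mono-≤ : ∀ {n} {f g : Fin n → ℚ} → (∀ i → f i ≤ g i) → sum f ≤ sum g
∑-mono-≤ {zero}  f≤g = ≤-refl
∑-mono-≤ {suc n} f≤g = +-mono-≤ (f≤g zero) (∑-mono-≤ (λ i → f≤g (suc i)))

∑∑ : ∀ {n} → (Fin n → Fin n → ℚ) → ℚ
∑∑ {n} f = ∑[ i < n ] ∑[ j < n ] f i j

∑∑-cong : ∀ {n} {f g : Fin n → Fin n → ℚ} → (∀ i j → f i j ≡ g i j) → ∑∑ f ≡ ∑∑ g
∑∑-cong f≡g = sum-cong-≗ (λ i → sum-cong-≗ (f≡g i))

∑∑-distrib-+ : ∀ {n} (f g : Fin n → Fin n → ℚ) → ∑∑ (λ i j → f i j + g i j) ≡ ∑∑ f + ∑∑ g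
∑∑-distrib-+ {n} f g = trans (sum-cong-≗ (λ i → ∑-distrib-+ (f i) (g i)))
  (∑-distrib-+ (λ i → ∑[ j < n ] f i j) (λ i → ∑[ j < n ] g i j))

∑∑-+-transpose : ∀ {n} (f : Fin n → Fin n → ℚ) → ∑∑ (λ i j → f i j + f j i) ≡ ∑∑ f + ∑∑ f
∑∑-+-transpose f = trans (∑∑-distrib-+ f (λ i j → f j i))
  (cong (λ s → ∑∑ f + s) (sym (∑-comm f)))

∑-indicator : ∀ {n} (b : Fin n → Bool) (x : ℚ) →
  ∑[ i < n ] (if b i then x else 0ℚ) ≡ ∣ tabulate b ∣ Mult.× x
∑-indicator {zero}  b x = refl
∑-indicator {suc n} b x with b zero
... | true  = cong (λ s → x + s) (∑-indicator (λ i → b (suc i)) x)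
... | false = trans (+-identityˡ _) (∑-indicator (λ i → b (suc i)) x)

×-nonNeg : ∀ n {x} → 0ℚ ≤ x → 0ℚ ≤ n Mult.× x
×-nonNeg zero    0≤x = ≤-refl
×-nonNeg (suc n) 0≤x = +-mono-≤ 0≤x (×-nonNeg n 0≤x)

×-monoˡ-≤ : ∀ {m n x} → 0ℚ ≤ x → m ℕ.≤ n → m Mult.× x ≤ n Mult.× x
×-monoˡ-≤ {n = n} 0≤x z≤n   = ×-nonNeg n 0≤x
×-monoˡ-≤ {x = x} 0≤x (s≤s m≤n) = +-monoʳ-≤ x (×-monoˡ-≤ 0≤x m≤n)

×1-* : ∀ n x → (n Mult.× 1ℚ) * x ≡ n Mult.× x
×1-* n x = trans (Mult.×-assoc-* n 1ℚ x) (cong (n Mult.×_) (*-identityˡ x))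

toℚᵘ-×1 : ∀ n → toℚᵘ (n Mult.× 1ℚ) ℚᵘ.≃ ℚᵘ.mkℚᵘ (+ n) 0
toℚᵘ-×1 zero    = ℚᵘ.≃-refl
toℚᵘ-×1 (suc n) = ℚᵘ.≃-trans (toℚᵘ-homo-+ 1ℚ (n Mult.× 1ℚ))
  (ℚᵘ.≃-trans (ℚᵘ.+-congʳ (toℚᵘ 1ℚ) (toℚᵘ-×1 n)) (ℚᵘ.*≡* cross-multiplied))
  where
  cross-multiplied : (+ 1 ℤ.* + 1 ℤ.+ + n ℤ.* + 1) ℤ.* + 1 ≡ + suc n ℤ.* + 1
  cross-multiplied = cong (λ m → (+ 1 ℤ.+ m) ℤ.* + 1) (ℤ.*-identityʳ (+ n))

i/n*[n×1]≡i/1 : ∀ i n .{{_ : NonZero n}} → (i / n) * (n Mult.× 1ℚ) ≡ i / 1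
i/n*[n×1]≡i/1 i (suc n) = toℚᵘ-injective (ℚᵘ.≃-trans (toℚᵘ-homo-* (i / suc n) (suc n Mult.× 1ℚ))
  (ℚᵘ.≃-trans (ℚᵘ.*-cong (toℚᵘ-fromℚᵘ (ℚᵘ.mkℚᵘ i n)) (toℚᵘ-×1 (suc n)))
    (ℚᵘ.≃-trans (ℚᵘ.*≡* cross-multiplied)
      (ℚᵘ.≃-sym (toℚᵘ-fromℚᵘ (ℚᵘ.mkℚᵘ i 0))))))
  where
  cross-multiplied : (i ℤ.* + suc n) ℤ.* + 1 ≡ i ℤ.* + (suc n ℕ.* 1)
  cross-multiplied = trans (ℤ.*-identityʳ _) (cong (λ m → i ℤ.* + m) (sym (ℕ.*-identityʳ (suc n))))

<ᵇ-asym : ∀ {m n} → (m <ᵇ n) ≡ true → (n <ᵇ m) ≡ true → ⊥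
<ᵇ-asym {m} {n} m<n n<m =
  ℕ.<-asym (ℕ.<ᵇ⇒< m n (subst T (sym m<n) _)) (ℕ.<ᵇ⇒< n m (subst T (sym n<m) _))

<ᵇ-connex : ∀ {m n} → (m <ᵇ n) ≡ false → (n <ᵇ m) ≡ false → m ≡ n
<ᵇ-connex {m} {n} m≮n n≮m = ℕ.≤-antisym
  (ℕ.≮⇒≥ (λ n<m → subst T n≮m (ℕ.<⇒<ᵇ n<m)))
  (ℕ.≮⇒≥ (λ m<n → subst T m≮n (ℕ.<⇒<ᵇ m<n)))

wt-comm : ∀ {n} (c : Fin n → ℚ) u v → wt c u v ≡ wt c v u
wt-comm c u v = cong (_* ½) (+-comm (c u) (c v))

½*x+½*x≡x : ∀ x → ½ * x + ½ * x ≡ x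
½*x+½*x≡x x = trans (sym (*-distribʳ-+ x ½ ½)) (*-identityˡ x)

module _ {n} (F : Graph n) (c : Fin n → ℚ) where

  orientedWeight : Fin n → Fin n → ℚ
  orientedWeight u v = if E F u v ∧ (toℕ u <ᵇ toℕ v) then wt c u v else 0ℚ

  edgeWeight : Fin n → Fin n → ℚ
  edgeWeight u v = if E F u v then wt c u v else 0ℚ

  incidence : Fin n → Fin n → ℚ
  incidence u v = if E F u v then c u else 0ℚ

  orientedWeight-+-flip : ∀ u v → orientedWeight u v + orientedWeight v u ≡ edgeWeight u v
  orientedWeight-+-flip u v rewrite E-sym F v u with E F u v in uv
  ... | false = refl
  ... | true with toℕ u <ᵇ toℕ v in u<v | toℕ v <ᵇ toℕ u in v<u
  ...   | true  | true  = ⊥-elim (<ᵇ-asym {toℕ u} u<v v<u)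
  ...   | true  | false = +-identityʳ _
  ...   | false | true  = trans (+-identityˡ _) (wt-comm c v u)
  ...   | false | false = ⊥-elim (adjacent⇒≢ F uv (toℕ-injective (<ᵇ-connex {toℕ u} u<v v<u)))

  edgeWeight-split : ∀ u v → edgeWeight u v ≡ ½ * incidence u v + ½ * incidence v u
  edgeWeight-split u v rewrite E-sym F v u with E F u v
  ... | false = refl
  ... | true  = trans (*-comm (c u + c v) ½) (*-distribˡ-+ ½ (c u) (c v))

  ∑-incidence : ∀ u → ∑[ v < n ] incidence u v ≡ degree F u Mult.× c u
  ∑-incidence u = ∑-indicator (E F u) (c u)

  handshake : wE c F + wE c F ≡ ∑[ u < n ] (degree F u Mult.× c u)
  handshake = begin
    wE c F + wE c F                                     ≡⟨ cong₂ _+_ wE≡∑∑ wE≡∑∑ ⟩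
    ∑∑ orientedWeight + ∑∑ orientedWeight               ≡⟨ ∑∑-+-transpose orientedWeight ⟨
    ∑∑ (λ u v → orientedWeight u v + orientedWeight v u) ≡⟨ ∑∑-cong orientedWeight-+-flip ⟩
    ∑∑ edgeWeight                                       ≡⟨ ∑∑-cong edgeWeight-split ⟩
    ∑∑ (λ u v → ½ * incidence u v + ½ * incidence v u)  ≡⟨ ∑∑-+-transpose (λ u v → ½ * incidence u v) ⟩
    ∑∑ (λ u v → ½ * incidence u v) + ∑∑ (λ u v → ½ * incidence u v)
      ≡⟨ ∑∑-distrib-+ (λ u v → ½ * incidence u v) (λ u v → ½ * incidence u v) ⟨
    ∑∑ (λ u v → ½ * incidence u v + ½ * incidence u v)  ≡⟨ ∑∑-cong (λ u v → ½*x+½*x≡x (incidence u v)) ⟩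
    ∑∑ incidence                                        ≡⟨ sum-cong-≗ ∑-incidence ⟩
    ∑[ u < n ] (degree F u Mult.× c u)                  ∎
    where
    open ≡-Reasoning
    wE≡∑∑ : wE c F ≡ ∑∑ orientedWeight
    wE≡∑∑ = trans (sumFin≡sum n _) (sum-cong-≗ (λ u → sumFin≡sum n (orientedWeight u)))

module _ {n k} {F : Graph n} (F-conn : KConnected k F)
         {c : Fin n → ℚ} (c≥0 : ∀ v → 0ℚ ≤ c v) where

  k*cV≤2*wE : (k Mult.× 1ℚ) * cV c F ≤ wE c F + wE c F
  k*cV≤2*wE = begin
    k′ * cV c F                         ≡⟨ cong (k′ *_) (sumFin≡sum n mass) ⟩
    k′ * ∑[ v < n ] mass v              ≡⟨ *-distribˡ-sum k′ mass ⟩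
    ∑[ v < n ] (k′ * mass v)            ≤⟨ ∑-mono-≤ vertex-bound ⟩
    ∑[ v < n ] (degree F v Mult.× c v)  ≡⟨ handshake F c ⟨
    wE c F + wE c F                     ∎
    where
    open ≤-Reasoning
    k′ = k Mult.× 1ℚ
    mass : Fin n → ℚ
    mass v = if lookup (V F) v then c v else 0ℚ
    vertex-bound : ∀ v → k′ * mass v ≤ degree F v Mult.× c v
    vertex-bound v with lookup (V F) v in v∈V
    ... | true  = ≤-trans (≤-reflexive (×1-* k (c v)))
                    (×-monoˡ-≤ (c≥0 v) (KConnected⇒k≤degree F F-conn (lookup⇒[]= v (V F) v∈V)))
    ... | false = ≤-trans (≤-reflexive (*-zeroʳ k′)) (×-nonNeg (degree F v) (c≥0 v))

  cV≤2/k*wE : .{{_ : NonZero k}} → cV c F ≤ (+ 2 / k) * wE c F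
  cV≤2/k*wE = *-cancelˡ-≤-pos 2ℚ (begin
    2ℚ * cV c F              ≡⟨ cong (_* cV c F) (i/n*[n×1]≡i/1 (+ 2) k) ⟨
    (r * k′) * cV c F        ≡⟨ *-assoc r k′ (cV c F) ⟩
    r * (k′ * cV c F)        ≤⟨ *-monoˡ-≤-nonNeg r k*cV≤2*wE ⟩
    r * (wE c F + wE c F)    ≡⟨ *-distribˡ-+ r (wE c F) (wE c F) ⟩
    r * wE c F + r * wE c F  ≡⟨ 2*x≡x+x (r * wE c F) ⟨
    2ℚ * (r * wE c F)        ∎)
    where
    open ≤-Reasoning
    2ℚ = + 2 / 1
    k′ = k Mult.× 1ℚ
    r = + 2 / k
    2*x≡x+x : ∀ x → 2ℚ * x ≡ x + x
    2*x≡x+x x = trans (*-distribʳ-+ x 1ℚ 1ℚ) (cong₂ _+_ (*-identityˡ x) (*-identityˡ x))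
    instance
      r≥0 : NonNegative r
      r≥0 = normalize-nonNeg 2 k

lemma5 : ∀ {n} (k : ℕ) .{{_ : NonZero k}} (G : Graph n) → KConnected k G →
    (c : Fin n → ℚ) → (∀ v → 0ℚ ≤ c v) →
    (T : Subset n) → T ⊆ V G →
    (F₀ F : Graph n) → Subgraph F₀ G → SubsetKConnected k F₀ T →
    KBlock k F₀ F → T ⊆ V F →
    cV c F ≤ (+ 2 / k) * wE c F
lemma5 _ _ _ _ c≥0 _ _ _ _ _ _ (_ , F-conn , _) _ = cV≤2/k*wE F-conn c≥0
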